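{- Let $p\ge 5$ be a prime such that $X^3-X-1$ has three distinct roots $\alpha,\beta,\gamma$ in $\mathbb{F}_p$. Let $(a_n)_{n\in\mathbb{Z}}$ be a complete Padovan sequence in $\mathbb{F}_p$ with initial values $(1,b,c)$, and assume $\gamma^2 b+\gamma c+1=0$, so that $a_n=A\alpha^n+B\beta^n$ for all $n$, where $A=\frac{\alpha^2 b+\alpha c+1}{2\alpha+3}$ and $B=\frac{\beta^2 b+\beta c+1}{2\beta+3}$. Let $N$ be the multiplicative order of $\alpha/\beta$ in $\mathbb{F}_p^*$, and for $k\ge 0$ let $I_k=\{j\in\mathbb{Z} : 0\le j\le k,\ \alpha^j\beta^{k-j}=1 \text{ in } \mathbb{F}_p\}$. Then $I_k\neq\varnothing$ for some $k\in\{1,\dots,p-2\}$. Moreover, for any $k\in\{1,\dots,p-2\}$ with $I_k\neq\varnothing$, we have $k=\ell(p-1)/N$ for some $\ell\in\{1,\dots,N-1\}$.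
   Context: A complete Padovan sequence in $\mathbb{F}_p$ is a sequence $(a_n)_{n\in\mathbb{Z}}$ in $\mathbb{F}_p$ with $a_0=1$, $a_{n+3}=a_n+a_{n+1}$ for all $n$, periodic with period $p-1$, and with $\{a_1,\dots,a_{p-2}\}=\{2,\dots,p-1\}$. -}

module Defs where

open import Data.Nat using (ℕ; zero; suc; _+_; _*_; _∸_; _^_; _≤_; _<_; NonZero)
open import Data.Nat.DivMod using (_%_)
open import Data.Integer as ℤ using (ℤ)
open import Data.Product using (Σ; ∃; _×_; _,_)
open import Relation.Binary.PropositionalEquality using (_≡_)
open import Relation.Nullary using (¬_)

-- Elements of F_p are represented by natural numbers; equality in F_p is
-- equality of residues mod p.
_≈[_]_ : ℕ → (p : ℕ) → .{{NonZero p}} → ℕ → Set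
x ≈[ p ] y = x % p ≡ y % p

infix 4 _≈[_]_

IsRoot : (p : ℕ) → .{{NonZero p}} → ℕ → Set
IsRoot p x = (x ^ 3) ≈[ p ] (x + 1)

record IsCompletePadovan (p : ℕ) .{{_ : NonZero p}} (a : ℤ → ℕ) : Set where
  field
    init     : a (ℤ.+ 0) ≈[ p ] 1
    recur    : ∀ (n : ℤ) → a (n ℤ.+ ℤ.+ 3) ≈[ p ] (a n + a (n ℤ.+ ℤ.+ 1))
    periodic : ∀ (n : ℤ) → a (n ℤ.+ ℤ.+ (p ∸ 1)) ≈[ p ] a n
    image⊆   : ∀ (i : ℕ) → 1 ≤ i → i ≤ p ∸ 2 →
               ∃ λ (m : ℕ) → 2 ≤ m × m ≤ p ∸ 1 × a (ℤ.+ i) ≈[ p ] m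
    image⊇   : ∀ (m : ℕ) → 2 ≤ m → m ≤ p ∸ 1 →
               ∃ λ (i : ℕ) → 1 ≤ i × i ≤ p ∸ 2 × a (ℤ.+ i) ≈[ p ] m

IsOrder : (p : ℕ) → .{{NonZero p}} → ℕ → ℕ → Set
IsOrder p q N = 1 ≤ N × (q ^ N) ≈[ p ] 1 × (∀ m → 1 ≤ m → (q ^ m) ≈[ p ] 1 → N ≤ m)

_∈I[_,_,_]_ : ℕ → (p : ℕ) → .{{NonZero p}} → ℕ → ℕ → ℕ → Set
j ∈I[ p , α , β ] k = j ≤ k × (α ^ j * β ^ (k ∸ j)) ≈[ p ] 1

I-nonempty : (p : ℕ) → .{{NonZero p}} → ℕ → ℕ → ℕ → Set
I-nonempty p α β k = ∃ λ j → j ∈I[ p , α , β ] k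

-- Since γ²b + γc + 1 = 0, the sequence has no γⁿ-part: it satisfies the second order recurrence
-- with characteristic roots α and β (Vieta: α + β = -γ, αβ = γ² - 1). Hence the differences
-- a(n+1) - β a(n) and a(n+1) - α a(n) are geometric with ratios α and β, and a(K) = a(0) whenever
-- αᴷ = βᴷ = 1. If αʲβᵏ⁻ʲ = 1, then αᴺ = βᴺ because (α/β)ᴺ = 1, so αᴺᵏ = βᴺᵏ = (αʲβᵏ⁻ʲ)ᴺ = 1 and
-- a(Nk) = a(0) = 1. A complete Padovan sequence takes the value 1 inside a period only at 0, so
-- p - 1 divides Nk, and 0 < k < p - 1 bounds the quotient. For existence, the p nonzero residues
-- α, β, αβ, …, αᵖ⁻²β cannot all differ, and any coincidence gives αʲβᵏ⁻ʲ = 1 with 1 ≤ k ≤ p - 2.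

module Submission where

open import Defs
open import Data.Nat.Base using (ℕ; NonZero)
open import Data.Nat.Primality using (Prime)

module Modulo (p : ℕ) where

  open import Level using (0ℓ)
  open import Data.Nat.Base as ℕ using (zero; suc; _≤_)
  import Data.Nat.Properties as ℕₚ
  open import Algebra.Bundles using (CommutativeRing)
  open import Data.Integer.Base using (ℤ; +_; _+_; _-_; _*_; -_; 0ℤ; 1ℤ; _%ℕ_; _/ℕ_)
  open import Data.Integer.DivMod using (a≡a%ℕn+[a/ℕn]*n)
  import Data.Integer.Properties as ℤ
  open import Data.Integer.Divisibility.Signed
    using (_∣_; divides; ∣m⇒∣-m; ∣m∣n⇒∣m+n; ∣m∣n⇒∣m-n; ∣m⇒∣m*n; ∣n⇒∣m*n)
  open import Data.Integer.Tactic.RingSolver using (solve)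
  open import Data.List.Base using (_∷_; [])
  open import Data.Product.Base using (∃; _×_; _,_)
  open import Relation.Binary.Core using (Rel)
  open import Relation.Binary.PropositionalEquality using (_≡_; refl; sym; trans; subst; cong; cong₂)
  open import Relation.Nullary using (¬_)

  infix 4 _≈_ _≉_
  infixl 1 _by_

  -- A record rather than a synonym for + p ∣ x - y, so that x and y can be inferred from a
  -- proof of x ≈ y (unification cannot see through ℤ's _-_ and _*_).
  record _≈_ (x y : ℤ) : Set where
    constructor mod
    field divides-difference : + p ∣ x - y

  open _≈_ public

  _≉_ : Rel ℤ 0ℓ
  x ≉ y = ¬ x ≈ y

  -- Polynomial steps are certified as (combination of hypotheses) by (ring identity).
  _by_ : ∀ {a b} → + p ∣ a → a ≡ b → + p ∣ b
  p∣a by a≡b = subst (+ p ∣_) a≡b p∣a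

  ≡⇒≈ : ∀ {x y} → x ≡ y → x ≈ y
  ≡⇒≈ {x} refl = mod (divides 0ℤ (ℤ.+-inverseʳ x))

  ≈-sym : ∀ {x y} → x ≈ y → y ≈ x
  ≈-sym {x} {y} (mod x≈y) = mod (∣m⇒∣-m x≈y by solve (x ∷ y ∷ []))

  ≈-trans : ∀ {x y z} → x ≈ y → y ≈ z → x ≈ z
  ≈-trans {x} {y} {z} (mod x≈y) (mod y≈z) = mod (∣m∣n⇒∣m+n x≈y y≈z by solve (x ∷ y ∷ z ∷ []))

  +-cong : ∀ {x y u v} → x ≈ y → u ≈ v → x + u ≈ y + v
  +-cong {x} {y} {u} {v} (mod x≈y) (mod u≈v) = mod (∣m∣n⇒∣m+n x≈y u≈v by solve (x ∷ y ∷ u ∷ v ∷ []))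

  *-cong : ∀ {x y u v} → x ≈ y → u ≈ v → x * u ≈ y * v
  *-cong {x} {y} {u} {v} (mod x≈y) (mod u≈v) =
    mod (∣m∣n⇒∣m+n (∣m⇒∣m*n u x≈y) (∣n⇒∣m*n y u≈v) by solve (x ∷ y ∷ u ∷ v ∷ []))

  -‿cong : ∀ {x y} → x ≈ y → - x ≈ - y
  -‿cong {x} {y} (mod x≈y) = mod (∣m⇒∣-m x≈y by solve (x ∷ y ∷ []))

  ℤ/p : CommutativeRing 0ℓ 0ℓ
  ℤ/p = record
    { Carrier = ℤ ; _≈_ = _≈_ ; _+_ = _+_ ; _*_ = _*_ ; -_ = -_ ; 0# = 0ℤ ; 1# = 1ℤ
    ; isCommutativeRing = record
      { isRing = record
        { +-isAbelianGroup = record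
          { isGroup = record
            { isMonoid = record
              { isSemigroup = record
                { isMagma = record
                  { isEquivalence = record { refl = ≡⇒≈ refl ; sym = ≈-sym ; trans = ≈-trans }
                  ; ∙-cong = +-cong }
                ; assoc = λ x y z → ≡⇒≈ (ℤ.+-assoc x y z) }
              ; identity = (λ x → ≡⇒≈ (ℤ.+-identityˡ x)) , (λ x → ≡⇒≈ (ℤ.+-identityʳ x)) }
            ; inverse = (λ x → ≡⇒≈ (ℤ.+-inverseˡ x)) , (λ x → ≡⇒≈ (ℤ.+-inverseʳ x))
            ; ⁻¹-cong = -‿cong }
          ; comm = λ x y → ≡⇒≈ (ℤ.+-comm x y) }
        ; *-cong = *-cong
        ; *-assoc = λ x y z → ≡⇒≈ (ℤ.*-assoc x y z)
        ; *-identity = (λ x → ≡⇒≈ (ℤ.*-identityˡ x)) , (λ x → ≡⇒≈ (ℤ.*-identityʳ x))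
        ; distrib = (λ x y z → ≡⇒≈ (ℤ.*-distribˡ-+ x y z)) , (λ x y z → ≡⇒≈ (ℤ.*-distribʳ-+ x y z)) }
      ; *-comm = λ x y → ≡⇒≈ (ℤ.*-comm x y) } }

  open CommutativeRing ℤ/p public
    using (setoid; *-congˡ; *-congʳ)
  open import Algebra.Properties.CommutativeSemiring.Exp (CommutativeRing.commutativeSemiring ℤ/p) public
    using (_^_; ^-congˡ; ^-homo-*; ^-assocʳ; ^-distrib-*)

  open import Relation.Binary.Reasoning.Setoid setoid public

  %ℕ-≡⇒≈ : .{{_ : NonZero p}} → ∀ x y → x %ℕ p ≡ y %ℕ p → x ≈ y
  %ℕ-≡⇒≈ x y x%p≡y%p = mod (divides (x /ℕ p - y /ℕ p)
    (trans (cong₂ _-_ (a≡a%ℕn+[a/ℕn]*n x p) (a≡a%ℕn+[a/ℕn]*n y p))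
           (cancel-remainder (x /ℕ p) (y /ℕ p) (+ p) (cong +_ x%p≡y%p))))
    where
    cancel-remainder : ∀ {r s} a b P → r ≡ s → (r + a * P) - (s + b * P) ≡ (a - b) * P
    cancel-remainder {r} a b P refl = solve (r ∷ a ∷ b ∷ P ∷ [])

  1^n≈1 : ∀ n → 1ℤ ^ n ≈ 1ℤ
  1^n≈1 zero = ≡⇒≈ refl
  1^n≈1 (suc n) = ≈-trans (≡⇒≈ (ℤ.*-identityˡ (1ℤ ^ n))) (1^n≈1 n)

  ^-equal-of-ratio : ∀ q α β N → q * β ≈ α → q ^ N ≈ 1ℤ → α ^ N ≈ β ^ N
  ^-equal-of-ratio q α β N qβ≈α qᴺ≈1 = begin
    α ^ N           ≈⟨ ^-congˡ N qβ≈α ⟨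
    (q * β) ^ N     ≈⟨ ^-distrib-* q β N ⟩
    q ^ N * β ^ N   ≈⟨ *-congʳ {β ^ N} qᴺ≈1 ⟩
    1ℤ * β ^ N      ≡⟨ ℤ.*-identityˡ (β ^ N) ⟩
    β ^ N           ∎

  HasUnitMonomial : ℤ → ℤ → ℕ → Set
  HasUnitMonomial α β k = ∃ λ j → j ≤ k × α ^ j * β ^ (k ℕ.∸ j) ≈ 1ℤ

  unit-monomial⇒^≈1 : ∀ α β N k → α ^ N ≈ β ^ N → HasUnitMonomial α β k →
                      α ^ (N ℕ.* k) ≈ 1ℤ × β ^ (N ℕ.* k) ≈ 1ℤ
  unit-monomial⇒^≈1 α β N k αᴺ≈βᴺ (j , j≤k , αʲβʳ≈1) = ≈-trans αᴺᵏ≈βᴺᵏ βᴺᵏ≈1 , βᴺᵏ≈1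
    where
    r : ℕ
    r = k ℕ.∸ j

    βᴺᵏ≈1 : β ^ (N ℕ.* k) ≈ 1ℤ
    βᴺᵏ≈1 = begin
      β ^ (N ℕ.* k)                   ≈⟨ ^-assocʳ β N k ⟨
      (β ^ N) ^ k                     ≡⟨ cong ((β ^ N) ^_) (ℕₚ.m+[n∸m]≡n j≤k) ⟨
      (β ^ N) ^ (j ℕ.+ r)             ≈⟨ ^-homo-* (β ^ N) j r ⟩
      (β ^ N) ^ j * (β ^ N) ^ r       ≈⟨ *-congʳ {(β ^ N) ^ r} (^-congˡ j αᴺ≈βᴺ) ⟨
      (α ^ N) ^ j * (β ^ N) ^ r       ≈⟨ *-cong (^-assocʳ α N j) (^-assocʳ β N r) ⟩
      α ^ (N ℕ.* j) * β ^ (N ℕ.* r)   ≡⟨ cong₂ (λ m n → α ^ m * β ^ n) (ℕₚ.*-comm N j) (ℕₚ.*-comm N r) ⟩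
      α ^ (j ℕ.* N) * β ^ (r ℕ.* N)   ≈⟨ *-cong (^-assocʳ α j N) (^-assocʳ β r N) ⟨
      (α ^ j) ^ N * (β ^ r) ^ N       ≈⟨ ^-distrib-* (α ^ j) (β ^ r) N ⟨
      (α ^ j * β ^ r) ^ N             ≈⟨ ^-congˡ N αʲβʳ≈1 ⟩
      1ℤ ^ N                          ≈⟨ 1^n≈1 N ⟩
      1ℤ                              ∎

    αᴺᵏ≈βᴺᵏ : α ^ (N ℕ.* k) ≈ β ^ (N ℕ.* k)
    αᴺᵏ≈βᴺᵏ = begin
      α ^ (N ℕ.* k)   ≈⟨ ^-assocʳ α N k ⟨
      (α ^ N) ^ k     ≈⟨ ^-congˡ k αᴺ≈βᴺ ⟩
      (β ^ N) ^ k     ≈⟨ ^-assocʳ β N k ⟩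
      β ^ (N ℕ.* k)   ∎

  Root : ℤ → Set
  Root x = x * x * x ≈ x + 1ℤ

  geometric : ∀ (e : ℕ → ℤ) x → (∀ n → e (suc n) ≈ x * e n) → ∀ n → e n ≈ x ^ n * e 0
  geometric e x step zero = ≡⇒≈ (sym (ℤ.*-identityˡ (e 0)))
  geometric e x step (suc n) = begin
    e (suc n)         ≈⟨ step n ⟩
    x * e n           ≈⟨ *-congˡ {x} (geometric e x step n) ⟩
    x * (x ^ n * e 0) ≡⟨ ℤ.*-assoc x (x ^ n) (e 0) ⟨
    x ^ suc n * e 0   ∎

  IsPadovan : (ℕ → ℤ) → Set
  IsPadovan u = ∀ n → u (suc (suc (suc n))) ≈ u n + u (suc n)

  -- On u = Aαⁿ + Bβⁿ + Cγⁿ this is (2γ + 3)Cγⁿ: it vanishes on αⁿ and βⁿ because αβγ = 1 and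
  -- α + β = -γ. The hypothesis γ²b + γc + 1 = 0 of the theorem says it vanishes at n = 0.
  γ-component : ℤ → (ℕ → ℤ) → ℕ → ℤ
  γ-component γ u n = γ * γ * u (suc n) + γ * u (suc (suc n)) + u n

  γ-component-shift : ∀ γ u → Root γ → IsPadovan u →
                      ∀ n → γ-component γ u (suc n) ≈ γ * γ-component γ u n
  γ-component-shift γ u (mod rγ) padovan n =
    shift (u n) (u (suc n)) (u (suc (suc n))) (u (suc (suc (suc n)))) (padovan n)
    where
    shift : ∀ u₀ u₁ u₂ u₃ → u₃ ≈ u₀ + u₁ → γ * γ * u₂ + γ * u₃ + u₁ ≈ γ * (γ * γ * u₁ + γ * u₂ + u₀)
    shift u₀ u₁ u₂ u₃ (mod rec) =
      mod (∣m∣n⇒∣m-n (∣n⇒∣m*n γ rec) (∣n⇒∣m*n u₁ rγ) by solve (γ ∷ u₀ ∷ u₁ ∷ u₂ ∷ u₃ ∷ []))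

  γ-component≈0 : ∀ γ u → Root γ → IsPadovan u → γ-component γ u 0 ≈ 0ℤ → ∀ n → γ-component γ u n ≈ 0ℤ
  γ-component≈0 γ u rγ padovan L₀≈0 n = begin
    γ-component γ u n           ≈⟨ geometric (γ-component γ u) γ (γ-component-shift γ u rγ padovan) n ⟩
    γ ^ n * γ-component γ u 0   ≈⟨ *-congˡ {γ ^ n} L₀≈0 ⟩
    γ ^ n * 0ℤ                  ≡⟨ ℤ.*-zeroʳ (γ ^ n) ⟩
    0ℤ                          ∎

module PrimeModulus {p : ℕ} (prime : Prime p) where

  open Modulo p
  open import Data.Nat.Base as ℕ using (zero; suc; _∸_; _≤_; _<_; z≤n; s≤s)
  import Data.Nat.DivMod as ℕ
  open import Data.Fin.Base using (Fin; toℕ; fromℕ<)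
  open import Data.Fin.Properties using (pigeonhole; toℕ<n; toℕ-fromℕ<)
  open import Data.Integer.DivMod using (n%ℕd<d)
  import Data.Nat.Properties as ℕₚ
  import Data.Nat.Divisibility as ℕ
  open import Data.Nat.Primality using (euclidsLemma; ¬prime[1]; prime⇒nonZero)
  open import Data.Integer.Base using (ℤ; +_; _+_; _-_; _*_; -_; 0ℤ; 1ℤ; ∣_∣; _%ℕ_)
  import Data.Integer.Properties as ℤ
  open import Data.Integer.Divisibility.Signed
    using (_∣_; ∣m∣n⇒∣m+n; ∣m∣n⇒∣m-n; ∣m⇒∣m*n; ∣n⇒∣m*n; ∣⇒∣ᵤ; ∣ᵤ⇒∣)
  open import Data.Integer.Tactic.RingSolver using (solve)
  open import Data.List.Base using (_∷_; [])
  open import Data.Product.Base using (∃; _×_; _,_; proj₁; proj₂)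
  open import Data.Sum.Base using (_⊎_; [_,_]′)
  import Data.Sum.Base as Sum
  open import Function.Base using (_∘_)
  open import Relation.Binary.PropositionalEquality using (_≡_; refl; sym; trans; subst; cong; cong₂)
  open import Relation.Nullary using (¬_; contradiction)

  euclid : ∀ x y → + p ∣ x * y → (+ p ∣ x) ⊎ (+ p ∣ y)
  euclid x y p∣xy = Sum.map ∣ᵤ⇒∣ ∣ᵤ⇒∣
    (euclidsLemma ∣ x ∣ ∣ y ∣ prime (subst (p ℕ.∣_) (ℤ.abs-* x y) (∣⇒∣ᵤ p∣xy)))

  p∤1 : ¬ (+ p ∣ 1ℤ)
  p∤1 p∣1 = ¬prime[1] (subst Prime (ℕ.∣1⇒≡1 (∣⇒∣ᵤ p∣1)) prime)

  ∤-* : ∀ {x y} → ¬ (+ p ∣ x) → ¬ (+ p ∣ y) → ¬ (+ p ∣ x * y)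
  ∤-* {x} {y} p∤x p∤y p∣xy = [ p∤x , p∤y ]′ (euclid x y p∣xy)

  ∤-^ : ∀ {x} → ¬ (+ p ∣ x) → ∀ n → ¬ (+ p ∣ x ^ n)
  ∤-^ p∤x zero = p∤1
  ∤-^ p∤x (suc n) = ∤-* p∤x (∤-^ p∤x n)

  *-cancelˡ : ∀ a x y → ¬ (+ p ∣ a) → a * x ≈ a * y → x ≈ y
  *-cancelˡ a x y p∤a (mod p∣ax-ay) =
    [ (λ p∣a → contradiction p∣a p∤a) , mod ]′ (euclid a (x - y) (p∣ax-ay by solve (a ∷ x ∷ y ∷ [])))

  root-inverse : ∀ γ → Root γ → γ * (γ * γ - 1ℤ) ≈ 1ℤ
  root-inverse γ (mod rγ) = mod (rγ by solve (γ ∷ []))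

  root-∤ : ∀ γ → Root γ → ¬ (+ p ∣ γ)
  root-∤ γ rγ p∣γ = p∤1
    (∣m∣n⇒∣m-n (∣m⇒∣m*n (γ * γ - 1ℤ) p∣γ) (divides-difference (root-inverse γ rγ)) by solve (γ ∷ []))

  roots-cofactor : ∀ x y → Root x → Root y → x ≉ y → x * x + x * y + y * y ≈ 1ℤ
  roots-cofactor x y (mod rx) (mod ry) x≉y =
    *-cancelˡ (x - y) _ _ (x≉y ∘ mod) (mod (∣m∣n⇒∣m-n rx ry by solve (x ∷ y ∷ [])))

  second-order-shifts : ∀ a b u₀ u₁ u₂ → u₂ ≈ (a + b) * u₁ - a * b * u₀ →
                        u₂ - b * u₁ ≈ a * (u₁ - b * u₀) × u₂ - a * u₁ ≈ b * (u₁ - a * u₀)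
  second-order-shifts a b u₀ u₁ u₂ (mod rec) =
    mod (rec by solve (a ∷ b ∷ u₀ ∷ u₁ ∷ u₂ ∷ [])) , mod (rec by solve (a ∷ b ∷ u₀ ∷ u₁ ∷ u₂ ∷ []))

  second-order-periodic : ∀ α β (u : ℕ → ℤ) → α ≉ β →
                          (∀ n → u (suc (suc n)) ≈ (α + β) * u (suc n) - α * β * u n) →
                          ∀ K → α ^ K ≈ 1ℤ → β ^ K ≈ 1ℤ → u K ≈ u 0
  second-order-periodic α β u α≉β recurrence K αᴷ≈1 βᴷ≈1 =
    *-cancelˡ (α - β) (u K) (u 0) (α≉β ∘ mod) (begin
      (α - β) * u K              ≈⟨ e-minus-f K ⟨
      e K - f K                  ≈⟨ +-cong (geometric e α e-step K) (-‿cong (geometric f β f-step K)) ⟩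
      α ^ K * e 0 - β ^ K * f 0  ≈⟨ +-cong (*-congʳ {e 0} αᴷ≈1) (-‿cong (*-congʳ {f 0} βᴷ≈1)) ⟩
      1ℤ * e 0 - 1ℤ * f 0        ≡⟨ cong₂ _-_ (ℤ.*-identityˡ (e 0)) (ℤ.*-identityˡ (f 0)) ⟩
      e 0 - f 0                  ≈⟨ e-minus-f 0 ⟩
      (α - β) * u 0              ∎)
    where
    e f : ℕ → ℤ
    e n = u (suc n) - β * u n
    f n = u (suc n) - α * u n

    e-step : ∀ n → e (suc n) ≈ α * e n
    e-step n = proj₁ (second-order-shifts α β (u n) (u (suc n)) (u (suc (suc n))) (recurrence n))

    f-step : ∀ n → f (suc n) ≈ β * f n
    f-step n = proj₂ (second-order-shifts α β (u n) (u (suc n)) (u (suc (suc n))) (recurrence n))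

    e-minus-f : ∀ n → e n - f n ≈ (α - β) * u n
    e-minus-f n = ≡⇒≈ (eliminate (u n) (u (suc n)))
      where
      eliminate : ∀ u₀ u₁ → (u₁ - β * u₀) - (u₁ - α * u₀) ≡ (α - β) * u₀
      eliminate u₀ u₁ = solve (α ∷ β ∷ u₀ ∷ u₁ ∷ [])

  module DistinctRoots (α β γ : ℤ) (rα : Root α) (rβ : Root β) (rγ : Root γ)
                       (α≉β : α ≉ β) (α≉γ : α ≉ γ) (β≉γ : β ≉ γ) where

    roots-sum : α + β ≈ - γ
    roots-sum = *-cancelˡ (β - γ) _ _ (β≉γ ∘ mod) (mod
      (∣m∣n⇒∣m-n (divides-difference (roots-cofactor α β rα rβ α≉β))
                 (divides-difference (roots-cofactor α γ rα rγ α≉γ)) by solve (α ∷ β ∷ γ ∷ [])))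

    roots-product : α * β ≈ γ * γ - 1ℤ
    roots-product = mod
      (∣m∣n⇒∣m-n (∣m⇒∣m*n (α + β - γ) (divides-difference roots-sum))
                 (divides-difference (roots-cofactor α β rα rβ α≉β)) by solve (α ∷ β ∷ γ ∷ []))

    -- γ(γ² - 1) = 1 and X² + γX + γ² - 1 = (X³ - X - 1) / (X - γ).
    padovan-quadratic : ∀ u₀ u₁ u₂ → γ * γ * u₁ + γ * u₂ + u₀ ≈ 0ℤ → u₂ + γ * u₁ + (γ * γ - 1ℤ) * u₀ ≈ 0ℤ
    padovan-quadratic u₀ u₁ u₂ (mod L≈0) = mod
      (∣m∣n⇒∣m-n (∣n⇒∣m*n (γ * γ - 1ℤ) L≈0)
                 (∣n⇒∣m*n (γ * u₁ + u₂) (divides-difference (root-inverse γ rγ)))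
        by solve (γ ∷ u₀ ∷ u₁ ∷ u₂ ∷ []))

    padovan-second-order : ∀ u₀ u₁ u₂ → γ * γ * u₁ + γ * u₂ + u₀ ≈ 0ℤ → u₂ ≈ (α + β) * u₁ - α * β * u₀
    padovan-second-order u₀ u₁ u₂ L≈0 = mod
      (∣m∣n⇒∣m+n (∣m∣n⇒∣m-n (divides-difference (padovan-quadratic u₀ u₁ u₂ L≈0))
                            (∣n⇒∣m*n u₁ (divides-difference roots-sum)))
                 (∣n⇒∣m*n u₀ (divides-difference roots-product))
        by solve (α ∷ β ∷ γ ∷ u₀ ∷ u₁ ∷ u₂ ∷ []))

    padovan-periodic : ∀ u → IsPadovan u → γ-component γ u 0 ≈ 0ℤ →
                       ∀ K → α ^ K ≈ 1ℤ → β ^ K ≈ 1ℤ → u K ≈ u 0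
    padovan-periodic u padovan L₀≈0 = second-order-periodic α β u α≉β λ n →
      padovan-second-order (u n) (u (suc n)) (u (suc (suc n))) (γ-component≈0 γ u rγ padovan L₀≈0 n)

  module Pigeonhole (α β : ℤ) (p∤α : ¬ (+ p ∣ α)) (p∤β : ¬ (+ p ∣ β)) (α≉β : α ≉ β) where

    private instance
      p≢0 : NonZero p
      p≢0 = prime⇒nonZero prime

    V : ℕ → ℤ
    V zero = α
    V (suc i) = α ^ i * β

    p∤V : ∀ i → ¬ (+ p ∣ V i)
    p∤V zero = p∤α
    p∤V (suc i) = ∤-* (∤-^ p∤α i) p∤β

    V-collision : ∀ {i j} → i < j → j < p → V i ≈ V j → ∃ λ k → 1 ≤ k × k ≤ p ∸ 2 × HasUnitMonomial α β k
    V-collision {zero} {suc zero} _ _ α≈β = contradiction (≈-trans α≈β (≡⇒≈ (ℤ.*-identityˡ β))) α≉β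
    V-collision {zero} {suc (suc t)} _ 3+t≤p α≈αᵗ⁺¹β =
      suc t , s≤s z≤n , ℕₚ.∸-monoˡ-≤ 2 3+t≤p , t , ℕₚ.n≤1+n t , αᵗβ≈1
      where
      α*αᵗβ≈α*1 : α * (α ^ t * β) ≈ α * 1ℤ
      α*αᵗβ≈α*1 = begin
        α * (α ^ t * β)  ≡⟨ ℤ.*-assoc α (α ^ t) β ⟨
        α ^ suc t * β    ≈⟨ α≈αᵗ⁺¹β ⟨
        α                ≡⟨ ℤ.*-identityʳ α ⟨
        α * 1ℤ           ∎

      αᵗβ≈1 : α ^ t * β ^ (suc t ∸ t) ≈ 1ℤ
      αᵗβ≈1 = begin
        α ^ t * β ^ (suc t ∸ t)  ≡⟨ cong (λ m → α ^ t * β ^ m) (ℕₚ.m+n∸n≡m 1 t) ⟩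
        α ^ t * β ^ 1            ≡⟨ cong (α ^ t *_) (ℤ.*-identityʳ β) ⟩
        α ^ t * β                ≈⟨ *-cancelˡ α _ _ p∤α α*αᵗβ≈α*1 ⟩
        1ℤ                       ∎
    V-collision {suc s} {suc t} (s≤s s<t) 2+t≤p αˢβ≈αᵗβ =
      d , ℕₚ.m<n⇒0<n∸m s<t , ℕₚ.≤-trans (ℕₚ.m∸n≤m t s) (ℕₚ.∸-monoˡ-≤ 2 2+t≤p) , d , ℕₚ.≤-refl , αᵈ≈1
      where
      d : ℕ
      d = t ∸ s

      αˢβ*αᵈ≈αˢβ*1 : α ^ s * β * α ^ d ≈ α ^ s * β * 1ℤ
      αˢβ*αᵈ≈αˢβ*1 = begin
        α ^ s * β * α ^ d        ≡⟨ swap (α ^ s) β (α ^ d) ⟩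
        α ^ s * α ^ d * β        ≈⟨ *-congʳ {β} (^-homo-* α s d) ⟨
        α ^ (s ℕ.+ d) * β        ≡⟨ cong (λ m → α ^ m * β) (ℕₚ.m+[n∸m]≡n (ℕₚ.<⇒≤ s<t)) ⟩
        α ^ t * β                ≈⟨ αˢβ≈αᵗβ ⟨
        α ^ s * β                ≡⟨ ℤ.*-identityʳ (α ^ s * β) ⟨
        α ^ s * β * 1ℤ           ∎
        where
        swap : ∀ x y z → x * y * z ≡ x * z * y
        swap x y z = solve (x ∷ y ∷ z ∷ [])

      αᵈ≈1 : α ^ d * β ^ (d ∸ d) ≈ 1ℤ
      αᵈ≈1 = begin
        α ^ d * β ^ (d ∸ d)  ≡⟨ cong (λ m → α ^ d * β ^ m) (ℕₚ.n∸n≡0 d) ⟩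
        α ^ d * 1ℤ           ≡⟨ ℤ.*-identityʳ (α ^ d) ⟩
        α ^ d                ≈⟨ *-cancelˡ (α ^ s * β) _ _ (p∤V (suc s)) αˢβ*αᵈ≈αˢβ*1 ⟩
        1ℤ                   ∎

    1≤residue : ∀ i → 1 ≤ V i %ℕ p
    1≤residue i with V i %ℕ p in V%p≡0
    ... | suc _ = s≤s z≤n
    ... | zero  = contradiction (divides-difference V≈0 by ℤ.+-identityʳ (V i)) (p∤V i)
      where
      V≈0 : V i ≈ 0ℤ
      V≈0 = %ℕ-≡⇒≈ (V i) 0ℤ (trans V%p≡0 (sym (ℕ.m<n⇒m%n≡m (ℕ.>-nonZero⁻¹ p))))

    residue : Fin p → Fin (p ∸ 1)
    residue i = fromℕ< (ℕₚ.∸-monoˡ-< (n%ℕd<d (V (toℕ i)) p) (1≤residue (toℕ i)))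

    residue-injective : ∀ i j → residue i ≡ residue j → V (toℕ i) ≈ V (toℕ j)
    residue-injective i j same = %ℕ-≡⇒≈ (V (toℕ i)) (V (toℕ j))
      (ℕₚ.∸-cancelʳ-≡ (1≤residue (toℕ i)) (1≤residue (toℕ j))
        (trans (sym (toℕ-fromℕ< _)) (trans (cong toℕ same) (toℕ-fromℕ< _))))

    exists-unit-monomial : ∃ λ k → 1 ≤ k × k ≤ p ∸ 2 × HasUnitMonomial α β k
    exists-unit-monomial =
      let i , j , i<j , same = pigeonhole p∸1<p residue
      in V-collision i<j (toℕ<n j) (residue-injective i j same)
      where
      p∸1<p : p ∸ 1 < p
      p∸1<p = ℕₚ.∸-monoʳ-< {p} {1} {0} (s≤s z≤n) (ℕ.>-nonZero⁻¹ p)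

module Residues (p : ℕ) .{{_ : NonZero p}} where

  open Modulo p
    using (_≈_; _≉_; mod; ≡⇒≈; ≈-trans; +-cong; *-congˡ; _^_; %ℕ-≡⇒≈; ^-equal-of-ratio;
           Root; HasUnitMonomial; IsPadovan; γ-component)
  open import Data.Nat.Base as ℕ using (zero; suc; _≤_)
  import Data.Nat.Properties as ℕₚ
  import Data.Nat.DivMod as ℕ
  import Data.Nat.Divisibility as ℕ
  open import Data.Integer.Base using (ℤ; +_; _+_; _*_; 0ℤ; 1ℤ; ∣_∣; _⊖_)
  import Data.Integer.Properties as ℤ
  open import Data.Integer.Divisibility.Signed using (∣⇒∣ᵤ)
  open import Data.Integer.Tactic.RingSolver using (solve)
  open import Data.List.Base using (_∷_; [])
  open import Data.Product.Base using (_,_)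
  open import Data.Sum.Base using (inj₁; inj₂)
  open import Function.Base using (_∘_)
  open import Relation.Binary.PropositionalEquality
    using (_≡_; refl; sym; trans; subst; subst₂; cong; cong₂)
  open import Relation.Nullary using (¬_)

  ≈[]⇒≈ : ∀ x y → x ≈[ p ] y → + x ≈ + y
  ≈[]⇒≈ x y = %ℕ-≡⇒≈ (+ x) (+ y)

  private
    ∣⊖∣⇒≈[] : ∀ {x y} → x ≤ y → p ℕ.∣ ∣ x ⊖ y ∣ → x ≈[ p ] y
    ∣⊖∣⇒≈[] {x} {y} x≤y p∣∣x⊖y∣ = sym (trans
      (cong (ℕ._% p) (sym (ℕₚ.m+[n∸m]≡n x≤y)))
      (ℕ.%-remove-+ʳ x (subst (p ℕ.∣_) (ℤ.∣⊖∣-≤ x≤y) p∣∣x⊖y∣)))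

  ≈⇒≈[] : ∀ x y → + x ≈ + y → x ≈[ p ] y
  ≈⇒≈[] x y (mod p∣x-y) with ℕₚ.≤-total x y
  ... | inj₁ x≤y = ∣⊖∣⇒≈[] x≤y p∣∣x⊖y∣
    where
    p∣∣x⊖y∣ : p ℕ.∣ ∣ x ⊖ y ∣
    p∣∣x⊖y∣ = subst (λ z → p ℕ.∣ ∣ z ∣) (ℤ.[+m]-[+n]≡m⊖n x y) (∣⇒∣ᵤ p∣x-y)
  ... | inj₂ y≤x = sym (∣⊖∣⇒≈[] y≤x p∣∣y⊖x∣)
    where
    p∣∣y⊖x∣ : p ℕ.∣ ∣ y ⊖ x ∣
    p∣∣y⊖x∣ = subst (p ℕ.∣_) (trans (cong ∣_∣ (ℤ.[+m]-[+n]≡m⊖n x y)) (ℤ.∣m⊖n∣≡∣n⊖m∣ x y)) (∣⇒∣ᵤ p∣x-y)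

  ≉[]⇒≉ : ∀ x y → ¬ x ≈[ p ] y → + x ≉ + y
  ≉[]⇒≉ x y x≉y = x≉y ∘ ≈⇒≈[] x y

  pos-^ : ∀ m n → + (m ℕ.^ n) ≡ (+ m) ^ n
  pos-^ m zero = refl
  pos-^ m (suc n) = trans (ℤ.pos-* m (m ℕ.^ n)) (cong (+ m *_) (pos-^ m n))

  pos-monomial : ∀ α β j r → + (α ℕ.^ j ℕ.* β ℕ.^ r) ≡ (+ α) ^ j * (+ β) ^ r
  pos-monomial α β j r = trans (ℤ.pos-* (α ℕ.^ j) (β ℕ.^ r)) (cong₂ _*_ (pos-^ α j) (pos-^ β r))

  ratio⇒^-equal : ∀ q α β N → (q ℕ.* β) ≈[ p ] α → (q ℕ.^ N) ≈[ p ] 1 → (+ α) ^ N ≈ (+ β) ^ N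
  ratio⇒^-equal q α β N qβ≈α qᴺ≈1 = ^-equal-of-ratio (+ q) (+ α) (+ β) N
    (≈-trans (≡⇒≈ (sym (ℤ.pos-* q β))) (≈[]⇒≈ _ _ qβ≈α))
    (≈-trans (≡⇒≈ (sym (pos-^ q N))) (≈[]⇒≈ _ 1 qᴺ≈1))

  IsRoot⇒Root : ∀ x → IsRoot p x → Root (+ x)
  IsRoot⇒Root x x³≈x+1 =
    ≈-trans (≡⇒≈ (trans (cube (+ x)) (sym (pos-^ x 3))))
            (≈-trans (≈[]⇒≈ _ _ x³≈x+1) (≡⇒≈ (ℤ.pos-+ x 1)))
    where
    cube : ∀ y → y * y * y ≡ y * (y * (y * 1ℤ))
    cube y = solve (y ∷ [])

  I-nonempty⇒HasUnitMonomial : ∀ α β k → I-nonempty p α β k → HasUnitMonomial (+ α) (+ β) k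
  I-nonempty⇒HasUnitMonomial α β k (j , j≤k , αʲβᵏ⁻ʲ≈1) =
    j , j≤k , ≈-trans (≡⇒≈ (sym (pos-monomial α β j (k ℕ.∸ j)))) (≈[]⇒≈ _ 1 αʲβᵏ⁻ʲ≈1)

  HasUnitMonomial⇒I-nonempty : ∀ α β k → HasUnitMonomial (+ α) (+ β) k → I-nonempty p α β k
  HasUnitMonomial⇒I-nonempty α β k (j , j≤k , αʲβᵏ⁻ʲ≈1) =
    j , j≤k , ≈⇒≈[] _ 1 (≈-trans (≡⇒≈ (pos-monomial α β j (k ℕ.∸ j))) αʲβᵏ⁻ʲ≈1)

  IsCompletePadovan⇒IsPadovan : ∀ {a} → IsCompletePadovan p a → IsPadovan (λ i → + a (+ i))
  IsCompletePadovan⇒IsPadovan {a} complete n =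
    subst₂ (λ i j → + a (+ i) ≈ + a (+ n) + + a (+ j)) (ℕₚ.+-comm n 3) (ℕₚ.+-comm n 1)
      (≈-trans (≈[]⇒≈ _ _ (IsCompletePadovan.recur complete (+ n)))
               (≡⇒≈ (ℤ.pos-+ (a (+ n)) (a (+ (n ℕ.+ 1))))))

  initial-γ-component≈0 : ∀ γ b c (u : ℕ → ℤ) → u 0 ≈ 1ℤ → u 1 ≈ + b → u 2 ≈ + c →
                  (γ ℕ.^ 2 ℕ.* b ℕ.+ γ ℕ.* c ℕ.+ 1) ≈[ p ] 0 → γ-component (+ γ) u 0 ≈ 0ℤ
  initial-γ-component≈0 γ b c u u₀≈1 u₁≈b u₂≈c γ²b+γc+1≈0 =
    ≈-trans (+-cong (+-cong (*-congˡ {+ γ * + γ} u₁≈b) (*-congˡ {+ γ} u₂≈c)) u₀≈1)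
            (≈-trans (≡⇒≈ (sym pos-value)) (≈[]⇒≈ _ 0 γ²b+γc+1≈0))
    where
    pos-value : + (γ ℕ.^ 2 ℕ.* b ℕ.+ γ ℕ.* c ℕ.+ 1) ≡ + γ * + γ * + b + + γ * + c + 1ℤ
    pos-value = trans (cong (λ g → + (γ ℕ.* g ℕ.* b ℕ.+ γ ℕ.* c ℕ.+ 1)) (ℕₚ.*-identityʳ γ))
      (trans (ℤ.pos-+ (γ ℕ.* γ ℕ.* b ℕ.+ γ ℕ.* c) 1)
        (cong (_+ 1ℤ) (trans (ℤ.pos-+ (γ ℕ.* γ ℕ.* b) (γ ℕ.* c))
          (cong₂ _+_ (trans (ℤ.pos-* (γ ℕ.* γ) b) (cong (_* + b) (ℤ.pos-* γ γ))) (ℤ.pos-* γ c)))))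

open import Data.Nat using (ℕ; suc; _+_; _*_; _∸_; _^_; _≤_; NonZero)
open import Data.Nat.Primality using (Prime)
open import Data.Integer using (ℤ; +_)
open import Data.Product using (∃; _×_)
open import Relation.Binary.PropositionalEquality using (_≡_)
open import Relation.Nullary using (¬_)
open import Data.Nat.Base using (zero; _<_; z≤n; s≤s; s≤s⁻¹)
import Data.Nat.Properties as ℕₚ
open import Data.Product.Base using (_,_)
open import Relation.Binary.PropositionalEquality using (sym; subst)
open import Relation.Nullary using (contradiction)
open import Data.Nat.Divisibility using (divides)

module CompletePadovan (n : ℕ) {a : ℤ → ℕ} (complete : IsCompletePadovan (2 + n) a) where

  open IsCompletePadovan complete
  open import Data.Nat.DivMod using (_%_; _/_; m≡m%n+[m/n]*n; m%n<n; m<n⇒m%n≡m)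
  open import Data.Nat.Divisibility using (_∣_; m%n≡0⇒n∣m)
  open import Relation.Binary.PropositionalEquality using (refl; trans; cong)

  periodic-multiple : ∀ r t → a (+ (r + t * suc n)) ≈[ 2 + n ] a (+ r)
  periodic-multiple r zero = cong (λ i → a (+ i) % (2 + n)) (ℕₚ.+-identityʳ r)
  periodic-multiple r (suc t) = trans
    (cong (λ i → a (+ i) % (2 + n))
      (trans (cong (λ s → r + s) (ℕₚ.+-comm (suc n) (t * suc n)))
             (sym (ℕₚ.+-assoc r (t * suc n) (suc n)))))
    (trans (periodic (+ (r + t * suc n))) (periodic-multiple r t))

  ≉1-inside-period : ∀ i → 1 ≤ i → i ≤ n → ¬ a (+ i) ≈[ 2 + n ] 1
  ≉1-inside-period i 1≤i i≤n aᵢ≈1 with m , 2≤m , m≤1+n , aᵢ≈m ← image⊆ i 1≤i i≤n =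
    ℕₚ.<⇒≢ 2≤m (sym (trans (sym (m<n⇒m%n≡m (s≤s m≤1+n)))
                    (trans (sym aᵢ≈m) (trans aᵢ≈1 (m<n⇒m%n≡m (s≤s (s≤s (z≤n {n}))))))))

  value-one⇒multiple : ∀ K → a (+ K) ≈[ 2 + n ] 1 → suc n ∣ K
  value-one⇒multiple K aₖ≈1 = m%n≡0⇒n∣m K (suc n) K%[1+n]≡0
    where
    aᵣ≈1 : a (+ (K % suc n)) ≈[ 2 + n ] 1
    aᵣ≈1 = trans (sym (periodic-multiple (K % suc n) (K / suc n)))
                 (trans (cong (λ i → a (+ i) % (2 + n)) (sym (m≡m%n+[m/n]*n K (suc n)))) aₖ≈1)

    K%[1+n]≡0 : K % suc n ≡ 0
    K%[1+n]≡0 with K % suc n in r≡ | m%n<n K (suc n)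
    ... | zero  | _ = refl
    ... | suc r | r<1+n =
      contradiction (subst (λ i → a (+ i) ≈[ 2 + n ] 1) r≡ aᵣ≈1)
                    (≉1-inside-period (suc r) (s≤s z≤n) (s≤s⁻¹ r<1+n))

multiple-bounds : ∀ {N k ℓ m} → 1 ≤ N → 1 ≤ k → k < m → N * k ≡ ℓ * m → 1 ≤ ℓ × ℓ ≤ N ∸ 1
multiple-bounds {ℓ = zero} 1≤N 1≤k _ Nk≡0 = contradiction (sym Nk≡0) (ℕₚ.<⇒≢ (ℕₚ.*-mono-≤ 1≤N 1≤k))
multiple-bounds {suc N} {k} {suc ℓ} {m} _ _ k<m Nk≡ℓm = s≤s z≤n , s≤s⁻¹ ℓ<N
  where
  ℓ<N : suc ℓ < suc N
  ℓ<N = ℕₚ.*-cancelʳ-< m (suc ℓ) (suc N) (subst (_< suc N * m) Nk≡ℓm (ℕₚ.*-monoʳ-< (suc N) k<m))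

lemma4p2 : (p : ℕ) .{{_ : NonZero p}} → Prime p → 5 ≤ p →
    (α β γ : ℕ) → IsRoot p α → IsRoot p β → IsRoot p γ →
    ¬ (α ≈[ p ] β) → ¬ (α ≈[ p ] γ) → ¬ (β ≈[ p ] γ) →
    (a : ℤ → ℕ) (b c : ℕ) → IsCompletePadovan p a →
    a (+ 1) ≈[ p ] b → a (+ 2) ≈[ p ] c →
    (γ ^ 2 * b + γ * c + 1) ≈[ p ] 0 →
    (q : ℕ) → (q * β) ≈[ p ] α →
    (N : ℕ) → IsOrder p q N →
    (∃ λ k → 1 ≤ k × k ≤ p ∸ 2 × I-nonempty p α β k)
    × (∀ k → 1 ≤ k → k ≤ p ∸ 2 → I-nonempty p α β k →
         ∃ λ ℓ → 1 ≤ ℓ × ℓ ≤ N ∸ 1 × N * k ≡ ℓ * (p ∸ 1))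
lemma4p2 .(2 + n) p-prime (s≤s (s≤s {n = n} _)) α β γ rα rβ rγ α≉β α≉γ β≉γ a b c complete a₁≈b a₂≈c
         γ²b+γc+1≈0 q qβ≈α N (1≤N , qᴺ≈1 , _) = some-I-nonempty , I-nonempty⇒multiple
  where
  open Modulo (2 + n) using (≈-trans; unit-monomial⇒^≈1)
  open PrimeModulus p-prime using (root-∤; module DistinctRoots; module Pigeonhole)
  open Residues (2 + n)
  open CompletePadovan n complete
  open IsCompletePadovan complete using (init)

  u : ℕ → ℤ
  u i = + a (+ i)

  open DistinctRoots (+ α) (+ β) (+ γ) (IsRoot⇒Root α rα) (IsRoot⇒Root β rβ) (IsRoot⇒Root γ rγ)
    (≉[]⇒≉ α β α≉β) (≉[]⇒≉ α γ α≉γ) (≉[]⇒≉ β γ β≉γ) using (padovan-periodic)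
  open Pigeonhole (+ α) (+ β) (root-∤ (+ α) (IsRoot⇒Root α rα)) (root-∤ (+ β) (IsRoot⇒Root β rβ))
    (≉[]⇒≉ α β α≉β) using (exists-unit-monomial)

  some-I-nonempty : ∃ λ k → 1 ≤ k × k ≤ n × I-nonempty (2 + n) α β k
  some-I-nonempty =
    let k , 1≤k , k≤n , unit = exists-unit-monomial
    in k , 1≤k , k≤n , HasUnitMonomial⇒I-nonempty α β k unit

  I-nonempty⇒multiple : ∀ k → 1 ≤ k → k ≤ n → I-nonempty (2 + n) α β k →
                        ∃ λ ℓ → 1 ≤ ℓ × ℓ ≤ N ∸ 1 × N * k ≡ ℓ * suc n
  I-nonempty⇒multiple k 1≤k k≤n I≢∅ =
    let αᴺᵏ≈1 , βᴺᵏ≈1 = unit-monomial⇒^≈1 (+ α) (+ β) N k (ratio⇒^-equal q α β N qβ≈α qᴺ≈1)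
                                          (I-nonempty⇒HasUnitMonomial α β k I≢∅)
        u₀≈1 = ≈[]⇒≈ _ 1 init
        γ-part≈0 = initial-γ-component≈0 γ b c u u₀≈1 (≈[]⇒≈ _ _ a₁≈b) (≈[]⇒≈ _ _ a₂≈c) γ²b+γc+1≈0
        uᴺᵏ≈u₀ = padovan-periodic u (IsCompletePadovan⇒IsPadovan complete) γ-part≈0 (N * k) αᴺᵏ≈1 βᴺᵏ≈1
        divides ℓ Nk≡ℓ[p-1] = value-one⇒multiple (N * k) (≈⇒≈[] _ 1 (≈-trans uᴺᵏ≈u₀ u₀≈1))
        1≤ℓ , ℓ≤N-1 = multiple-bounds 1≤N 1≤k (s≤s k≤n) Nk≡ℓ[p-1]
    in ℓ , 1≤ℓ , ℓ≤N-1 , Nk≡ℓ[p-1]
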